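{- Let $G_1=(V_1,E_1)$ and $G_2=(V_2,E_2)$ be finite simple graphs with maximum degrees $\Delta_1,\Delta_2$ respectively, and let $S\subseteq V_1\times V_2$. Then: (i) If for some $i\in\{1,2\}$ the projection $P_{V_i}(S)$ is a $k_i$-daf set in $G_i$, then $S$ is a $(k_i+\Delta_j)$-daf set in $G_1\times G_2$, where $j\in\{1,2\}$, $j\neq i$. (ii) If for every $i\in\{1,2\}$ the projection $P_{V_i}(S)$ is a $k_i$-daf set in $G_i$, then $S$ is a $(k_1+k_2-1)$-daf set in $G_1\times G_2$.
   Context: For a graph $G=(V,E)$, a set $S\subseteq V$ and $v\in V$, $\delta_S(v)=|\{u\in S: uv\in E\}|$ and $\overline{S}=V\setminus S$. For an integer $k$, a non-empty set $S\subseteq V$ is a defensive $k$-alliance if $\delta_S(v)\ge \delta_{\overline{S}}(v)+k$ for every $v\in S$. A set $X\subseteq V$ is defensive $k$-alliance free ($k$-daf) if $X$ contains no defensive $k$-alliance as a subset. The Cartesian product $G_1\times G_2$ has vertex set $V_1\times V_2$, with $(a,b)$ adjacent to $(c,d)$ iff either $a=c$ and $bd\in E_2$, or $b=d$ and $ac\in E_1$. For $A\subseteq V_1\times V_2$, $P_{V_i}(A)$ denotes the projection of $A$ onto $V_i$. -}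

module Defs where

open import Data.Bool using (Bool; true; false; _∧_; T; if_then_else_)
open import Data.Nat using (ℕ; zero; suc; _+_; _⊔_)
open import Data.Integer using (ℤ; +_; _-_; _≤_)
open import Data.Fin using (Fin)
open import Data.Product using (_×_; _,_; proj₁; proj₂; ∃-syntax)
open import Relation.Binary.PropositionalEquality using (_≡_)
open import Relation.Nullary using (¬_)

Σ[_]_ : (n : ℕ) → (Fin n → ℕ) → ℕ
Σ[ zero ] f = 0
Σ[ suc n ] f = f Fin.zero + Σ[ n ] (λ i → f (Fin.suc i))

Max[_]_ : (n : ℕ) → (Fin n → ℕ) → ℕ
Max[ zero ] f = 0
Max[ suc n ] f = f Fin.zero ⊔ Max[ n ] (λ i → f (Fin.suc i))

count : (n : ℕ) → (Fin n → Bool) → ℕ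
count n p = Σ[ n ] (λ i → if p i then 1 else 0)

record Graph (n : ℕ) : Set where
  field
    adj   : Fin n → Fin n → Bool
    sym   : ∀ u v → adj u v ≡ adj v u
    irrefl : ∀ v → adj v v ≡ false
open Graph public

VSet : ℕ → Set
VSet n = Fin n → Bool

not : Bool → Bool
not true = false
not false = true

complement : ∀ {n} → VSet n → VSet n
complement S v = not (S v)

δ : ∀ {n} → Graph n → VSet n → Fin n → ℕ
δ {n} G S v = count n (λ u → S u ∧ adj G u v)

deg : ∀ {n} → Graph n → Fin n → ℕ
deg {n} G v = count n (λ u → adj G u v)

maxDeg : ∀ {n} → Graph n → ℕ
maxDeg {n} G = Max[ n ] (deg G)

_⊆_ : ∀ {n} → VSet n → VSet n → Set
A ⊆ B = ∀ v → T (A v) → T (B v)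

NonEmpty : ∀ {n} → VSet n → Set
NonEmpty S = ∃[ v ] T (S v)

IsDefensiveAlliance : ∀ {n} → Graph n → ℤ → VSet n → Set
IsDefensiveAlliance G k S =
  NonEmpty S × (∀ v → T (S v) → (+ δ G (complement S) v) Data.Integer.+ k ≤ + δ G S v)

IsDAF : ∀ {n} → Graph n → ℤ → VSet n → Set
IsDAF G k X = ∀ S → S ⊆ X → ¬ IsDefensiveAlliance G k S

open import Data.Nat using (_*_)
open import Data.Fin using (combine; remQuot)
open import Data.Fin using (_≟_)
open import Relation.Nullary.Decidable using (⌊_⌋)

open import Relation.Binary.PropositionalEquality using (refl; cong₂; trans)
open import Data.Bool.Properties using (∧-comm; ∨-comm)
open import Relation.Nullary using (yes; no)

private
  ⌊≟⌋-sym : ∀ {m} (a c : Fin m) → ⌊ a ≟ c ⌋ ≡ ⌊ c ≟ a ⌋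
  ⌊≟⌋-sym a c with a ≟ c | c ≟ a
  ... | yes _ | yes _ = refl
  ... | no _ | no _ = refl
  ... | yes refl | no ¬p with ¬p refl
  ... | ()
  ⌊≟⌋-sym a c | no ¬p | yes refl with ¬p refl
  ... | ()

  ⌊≟⌋-refl : ∀ {m} (a : Fin m) → ⌊ a ≟ a ⌋ ≡ true
  ⌊≟⌋-refl a with a ≟ a
  ... | yes _ = refl
  ... | no ¬p with ¬p refl
  ... | ()

-- Cartesian product. Vertex (a , b) of V₁ × V₂ is encoded in Fin (n₁ * n₂)
-- via Data.Fin.remQuot / combine (a bijection).
prodAdj : ∀ {n₁ n₂} → Graph n₁ → Graph n₂ → Fin n₁ × Fin n₂ → Fin n₁ × Fin n₂ → Bool
prodAdj G₁ G₂ (a , b) (c , d) =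
  (⌊ a ≟ c ⌋ ∧ adj G₂ b d) Data.Bool.∨ (⌊ b ≟ d ⌋ ∧ adj G₁ a c)

_×ᴳ_ : ∀ {n₁ n₂} → Graph n₁ → Graph n₂ → Graph (n₁ * n₂)
_×ᴳ_ {n₁} {n₂} G₁ G₂ = record { adj = A ; sym = s ; irrefl = ir }
  where
  A : Fin (n₁ * n₂) → Fin (n₁ * n₂) → Bool
  A x y = prodAdj G₁ G₂ (remQuot n₂ x) (remQuot n₂ y)
  s' : ∀ p q → prodAdj G₁ G₂ p q ≡ prodAdj G₁ G₂ q p
  s' (a , b) (c , d) rewrite ⌊≟⌋-sym a c | ⌊≟⌋-sym b d | Graph.sym G₂ b d | Graph.sym G₁ a c = refl
  s : ∀ u v → A u v ≡ A v u
  s u v = s' (remQuot n₂ u) (remQuot n₂ v)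
  ir' : ∀ p → prodAdj G₁ G₂ p p ≡ false
  ir' (a , b) rewrite ⌊≟⌋-refl a | ⌊≟⌋-refl b | Graph.irrefl G₂ b | Graph.irrefl G₁ a = refl
  ir : ∀ v → A v v ≡ false
  ir v = ir' (remQuot n₂ v)

any[_]_ : (n : ℕ) → (Fin n → Bool) → Bool
any[ zero ] f = false
any[ suc n ] f = f Fin.zero Data.Bool.∨ any[ n ] (λ i → f (Fin.suc i))

proj₁ᴾ : ∀ {n₁ n₂} → VSet (n₁ * n₂) → VSet n₁
proj₁ᴾ {n₁} {n₂} S a = any[ n₂ ] (λ b → S (combine a b))

proj₂ᴾ : ∀ {n₁ n₂} → VSet (n₁ * n₂) → VSet n₂
proj₂ᴾ {n₁} {n₂} S b = any[ n₁ ] (λ a → S (combine a b))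

-- Write a vertex of G₁ × G₂ as (a , b).  Its neighbourhood splits into the
-- column {(c , b) : ca ∈ E₁} and the row {(a , e) : eb ∈ E₂}, so for every X
--   δ_X(a , b) = δ_{column X b}(a) + δ_{row X a}(b)        (δ-product).
-- The column (resp. row) through a vertex of X lies in the projection of X,
-- and the row part is bounded by Δ₂.  Hence a defensive (k + Δ₂)-alliance
-- S' ⊆ S of the product projects to a defensive k-alliance P₁(S') ⊆ P₁(S)
-- of G₁ (projection-alliance₁); symmetrically for the second coordinate.
-- This gives (i).  For (ii), let S' ⊆ S be a (k₁ + k₂ - 1)-alliance.  Its
-- projection P₁(S') ⊆ P₁(S) is not a k₁-alliance, so some a ∈ P₁(S') fails
-- the k₁-alliance condition; then the row {e : (a , e) ∈ S'} ⊆ P₂(S) is a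
-- k₂-alliance of G₂ (row-alliance), a contradiction.

module Submission where

open import Defs hiding (sym)
open import Data.Bool using (Bool; true; false; _∧_; T; if_then_else_)
open import Data.Bool.Properties using (T?; ∧-zeroʳ)
open import Data.Nat as ℕ using (ℕ; zero; suc; _*_; z≤n)
import Data.Nat.Properties as ℕP
open import Data.Nat.Tactic.RingSolver using (solve-∀)
open import Data.Integer using (ℤ; +_; _+_; _-_; -_; _≤_; +≤+)
import Data.Integer.Properties as ℤP
open import Data.Integer.Tactic.RingSolver as ℤSolver using ()
open import Data.Fin as F using (Fin; combine; remQuot; _↑ˡ_; _↑ʳ_)
open import Data.Fin.Properties using (remQuot-combine; combine-remQuot; ¬∀⟶∃¬)
open import Data.Product using (_×_; _,_; proj₁; proj₂; ∃-syntax)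
open import Data.Empty using (⊥-elim)
open import Data.Unit using (tt)
open import Relation.Binary.PropositionalEquality
open import Relation.Nullary using (¬_; Dec; yes; no; _→-dec_)
open import Relation.Nullary.Decidable using (⌊_⌋)

indicator : Bool → ℕ
indicator b = if b then 1 else 0

Σ-cong : ∀ n {f g : Fin n → ℕ} → (∀ i → f i ≡ g i) → Σ[ n ] f ≡ Σ[ n ] g
Σ-cong zero    f≡g = refl
Σ-cong (suc n) f≡g = cong₂ ℕ._+_ (f≡g F.zero) (Σ-cong n (λ i → f≡g (F.suc i)))

Σ-mono : ∀ n {f g : Fin n → ℕ} → (∀ i → f i ℕ.≤ g i) → Σ[ n ] f ℕ.≤ Σ[ n ] g
Σ-mono zero    f≤g = z≤n
Σ-mono (suc n) f≤g = ℕP.+-mono-≤ (f≤g F.zero) (Σ-mono n (λ i → f≤g (F.suc i)))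

Σ-+ : ∀ n (f g : Fin n → ℕ) → Σ[ n ] (λ i → f i ℕ.+ g i) ≡ Σ[ n ] f ℕ.+ Σ[ n ] g
Σ-+ zero    f g = refl
Σ-+ (suc n) f g
  rewrite Σ-+ n (λ i → f (F.suc i)) (λ i → g (F.suc i)) =
  interchange (f F.zero) (g F.zero) (Σ[ n ] (λ i → f (F.suc i))) (Σ[ n ] (λ i → g (F.suc i)))
  where
  interchange : ∀ a b c d → (a ℕ.+ b) ℕ.+ (c ℕ.+ d) ≡ (a ℕ.+ c) ℕ.+ (b ℕ.+ d)
  interchange = solve-∀

Σ-zero : ∀ n → Σ[ n ] (λ _ → 0) ≡ 0
Σ-zero zero    = refl
Σ-zero (suc n) = Σ-zero n

Σ-guard : ∀ n (t : Bool) (f : Fin n → ℕ) →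
  Σ[ n ] (λ i → if t then f i else 0) ≡ (if t then Σ[ n ] f else 0)
Σ-guard n true  f = refl
Σ-guard n false f = Σ-zero n

suc-≟ : ∀ {n} (i j : Fin n) → ⌊ F.suc i F.≟ F.suc j ⌋ ≡ ⌊ i F.≟ j ⌋
suc-≟ i j with i F.≟ j
... | yes _ = refl
... | no  _ = refl

Σ-delta : ∀ n (a : Fin n) (f : Fin n → ℕ) → Σ[ n ] (λ i → if ⌊ i F.≟ a ⌋ then f i else 0) ≡ f a
Σ-delta (suc n) F.zero    f = trans (cong (f F.zero ℕ.+_) (Σ-zero n)) (ℕP.+-identityʳ (f F.zero))
Σ-delta (suc n) (F.suc a) f =
  trans (Σ-cong n (λ i → cong (λ t → if t then f (F.suc i) else 0) (suc-≟ i a)))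
        (Σ-delta n a (λ i → f (F.suc i)))

Σ-++ : ∀ m n (f : Fin (m ℕ.+ n) → ℕ) →
  Σ[ m ℕ.+ n ] f ≡ Σ[ m ] (λ i → f (i ↑ˡ n)) ℕ.+ Σ[ n ] (λ i → f (m ↑ʳ i))
Σ-++ zero    n f = refl
Σ-++ (suc m) n f =
  trans (cong (f F.zero ℕ.+_) (Σ-++ m n (λ i → f (F.suc i)))) (sym (ℕP.+-assoc (f F.zero) _ _))

Σ-product : ∀ m n (f : Fin (m * n) → ℕ) → Σ[ m * n ] f ≡ Σ[ m ] (λ c → Σ[ n ] (λ d → f (combine c d)))
Σ-product zero    n f = refl
Σ-product (suc m) n f =
  trans (Σ-++ n (m * n) f) (cong (Σ[ n ] (λ d → f (d ↑ˡ (m * n))) ℕ.+_) (Σ-product m n (λ i → f (n ↑ʳ i))))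

Max-upper : ∀ n (f : Fin n → ℕ) i → f i ℕ.≤ Max[ n ] f
Max-upper (suc n) f F.zero    = ℕP.m≤m⊔n _ _
Max-upper (suc n) f (F.suc i) = ℕP.≤-trans (Max-upper n (λ j → f (F.suc j)) i) (ℕP.m≤n⊔m (f F.zero) _)

any-intro : ∀ n (f : Fin n → Bool) i → T (f i) → T (any[ n ] f)
any-intro (suc n) f F.zero    fi with f F.zero
... | true = tt
any-intro (suc n) f (F.suc i) fi with f F.zero
... | true  = tt
... | false = any-intro n (λ j → f (F.suc j)) i fi

any-elim : ∀ n (f : Fin n → Bool) → T (any[ n ] f) → ∃[ i ] T (f i)
any-elim (suc n) f any with f F.zero in eq
... | true  = F.zero , subst T (sym eq) tt
... | false with any-elim n (λ j → f (F.suc j)) any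
...   | i , fi = F.suc i , fi

∧-monoˡ : ∀ {x y z} → (T x → T y) → T (x ∧ z) → T (y ∧ z)
∧-monoˡ {true}  {true}  x⇒y xz = xz
∧-monoˡ {true}  {false} x⇒y xz = ⊥-elim (x⇒y tt)

∧-elimʳ : ∀ {x y} → T (x ∧ y) → T y
∧-elimʳ {true} xy = xy

complement-antitone : ∀ {n} {A B : VSet n} → A ⊆ B → complement B ⊆ complement A
complement-antitone {A = A} {B} A⊆B v notB with A v in eq
... | false = tt
... | true  with B v | A⊆B v (subst T (sym eq) tt)
...   | true | _ = notB

indicator-mono : ∀ {x y} → (T x → T y) → indicator x ℕ.≤ indicator y
indicator-mono {false}         x⇒y = z≤n
indicator-mono {true}  {true}  x⇒y = ℕP.≤-refl
indicator-mono {true}  {false} x⇒y = ⊥-elim (x⇒y tt)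

δ-mono : ∀ {n} (G : Graph n) {A B : VSet n} → A ⊆ B → ∀ v → δ G A v ℕ.≤ δ G B v
δ-mono {n} G A⊆B v = Σ-mono n (λ u → indicator-mono (∧-monoˡ (A⊆B u)))

δ≤maxDeg : ∀ {n} (G : Graph n) (A : VSet n) v → δ G A v ℕ.≤ maxDeg G
δ≤maxDeg {n} G A v =
  ℕP.≤-trans (Σ-mono n (λ u → indicator-mono ∧-elimʳ)) (Max-upper n (deg G) v)

module _ {n₁ n₂ : ℕ} where

  column : VSet (n₁ * n₂) → Fin n₂ → VSet n₁
  column X b c = X (combine c b)

  row : VSet (n₁ * n₂) → Fin n₁ → VSet n₂
  row X a e = X (combine a e)

  column⊆proj₁ : ∀ X b → column X b ⊆ proj₁ᴾ {n₁} {n₂} X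
  column⊆proj₁ X b c = any-intro n₂ (row X c) b

  row⊆proj₂ : ∀ X a → row X a ⊆ proj₂ᴾ {n₁} {n₂} X
  row⊆proj₂ X a e = any-intro n₁ (column X e) a

  proj₁-mono : ∀ {X Y} → X ⊆ Y → proj₁ᴾ {n₁} {n₂} X ⊆ proj₁ᴾ {n₁} {n₂} Y
  proj₁-mono {X} {Y} X⊆Y a aX with any-elim n₂ (row X a) aX
  ... | b , abX = any-intro n₂ (row Y a) b (X⊆Y (combine a b) abX)

  proj₂-mono : ∀ {X Y} → X ⊆ Y → proj₂ᴾ {n₁} {n₂} X ⊆ proj₂ᴾ {n₁} {n₂} Y
  proj₂-mono {X} {Y} X⊆Y b bX with any-elim n₁ (column X b) bX
  ... | a , abX = any-intro n₁ (column Y b) a (X⊆Y (combine a b) abX)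

  member-as-pair : ∀ X → NonEmpty X → ∃[ a ] ∃[ b ] T (X (combine a b))
  member-as-pair X (v , vX) =
    proj₁ (remQuot {n₁} n₂ v) , proj₂ (remQuot {n₁} n₂ v) ,
    subst (λ w → T (X w)) (sym (combine-remQuot {n₁} n₂ v)) vX

  proj₁-nonempty : ∀ X → NonEmpty X → NonEmpty (proj₁ᴾ {n₁} {n₂} X)
  proj₁-nonempty X ne with member-as-pair X ne
  ... | a , b , abX = a , any-intro n₂ (row X a) b abX

  proj₂-nonempty : ∀ X → NonEmpty X → NonEmpty (proj₂ᴾ {n₁} {n₂} X)
  proj₂-nonempty X ne with member-as-pair X ne
  ... | a , b , abX = b , any-intro n₁ (column X b) a abX

-- A neighbour (c , d) of (a , b) shares either its first coordinate
-- (and then db ∈ E₂) or its second one (and then ca ∈ E₁), never both.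
adjacency-split : ∀ {n₁ n₂} (G₁ : Graph n₁) (G₂ : Graph n₂) (x : Bool) (c a : Fin n₁) (d b : Fin n₂) →
  indicator (x ∧ prodAdj G₁ G₂ (c , d) (a , b)) ≡
  (if ⌊ c F.≟ a ⌋ then indicator (x ∧ adj G₂ d b) else 0) ℕ.+
  (if ⌊ d F.≟ b ⌋ then indicator (x ∧ adj G₁ c a) else 0)
adjacency-split G₁ G₂ x c a d b with c F.≟ a | d F.≟ b
... | yes refl | yes refl rewrite irrefl G₂ d | irrefl G₁ c | ∧-zeroʳ x = refl
... | yes refl | no _ with x | adj G₂ d b
...   | true  | true  = refl
...   | true  | false = refl
...   | false | _     = refl
adjacency-split G₁ G₂ x c a d b | no _ | yes refl with x | adj G₁ c a
...   | true  | true  = refl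
...   | true  | false = refl
...   | false | _     = refl
adjacency-split G₁ G₂ x c a d b | no _ | no _ rewrite ∧-zeroʳ x = refl

δ-product : ∀ {n₁ n₂} (G₁ : Graph n₁) (G₂ : Graph n₂) (X : VSet (n₁ * n₂)) a b →
  δ (G₁ ×ᴳ G₂) X (combine a b) ≡ δ G₁ (column X b) a ℕ.+ δ G₂ (row X a) b
δ-product {n₁} {n₂} G₁ G₂ X a b = begin
  δ (G₁ ×ᴳ G₂) X (combine a b)
    ≡⟨ Σ-product n₁ n₂ _ ⟩
  Σ[ n₁ ] (λ c → Σ[ n₂ ] (λ d → indicator (X (combine c d) ∧
    prodAdj G₁ G₂ (remQuot n₂ (combine c d)) (remQuot n₂ (combine a b)))))
    ≡⟨ Σ-cong n₁ (λ c → Σ-cong n₂ (λ d → cong₂ (λ p q → indicator (X (combine c d) ∧ prodAdj G₁ G₂ p q))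
                                               (remQuot-combine c d) (remQuot-combine a b))) ⟩
  Σ[ n₁ ] (λ c → Σ[ n₂ ] (λ d → indicator (X (combine c d) ∧ prodAdj G₁ G₂ (c , d) (a , b))))
    ≡⟨ Σ-cong n₁ (λ c → Σ-cong n₂ (λ d → adjacency-split G₁ G₂ (X (combine c d)) c a d b)) ⟩
  Σ[ n₁ ] (λ c → Σ[ n₂ ] (λ d → inRow c d ℕ.+ inColumn c d))
    ≡⟨ Σ-cong n₁ (λ c → Σ-+ n₂ (inRow c) (inColumn c)) ⟩
  Σ[ n₁ ] (λ c → Σ[ n₂ ] (inRow c) ℕ.+ Σ[ n₂ ] (inColumn c))
    ≡⟨ Σ-+ n₁ _ _ ⟩
  Σ[ n₁ ] (λ c → Σ[ n₂ ] (inRow c)) ℕ.+ Σ[ n₁ ] (λ c → Σ[ n₂ ] (inColumn c))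
    ≡⟨ cong₂ ℕ._+_ (trans (Σ-cong n₁ (λ c → Σ-guard n₂ ⌊ c F.≟ a ⌋ _)) (Σ-delta n₁ a _))
                   (Σ-cong n₁ (λ c → Σ-delta n₂ b _)) ⟩
  δ G₂ (row X a) b ℕ.+ δ G₁ (column X b) a
    ≡⟨ ℕP.+-comm (δ G₂ (row X a) b) _ ⟩
  δ G₁ (column X b) a ℕ.+ δ G₂ (row X a) b ∎
  where
  open ≡-Reasoning
  inRow : Fin n₁ → Fin n₂ → ℕ
  inRow c d = if ⌊ c F.≟ a ⌋ then indicator (X (combine c d) ∧ adj G₂ d b) else 0
  inColumn : Fin n₁ → Fin n₂ → ℕ
  inColumn c d = if ⌊ d F.≟ b ⌋ then indicator (X (combine c d) ∧ adj G₁ c a) else 0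

+-cancelʳ-≤ : (i j k : ℤ) → i + k ≤ j + k → i ≤ j
+-cancelʳ-≤ i j k i+k≤j+k = subst₂ _≤_ (undo i) (undo j) (ℤP.+-monoˡ-≤ (- k) i+k≤j+k)
  where
  undo : ∀ x → x + k + - k ≡ x
  undo x = trans (ℤP.+-assoc x k (- k)) (trans (cong (λ y → x + y) (ℤP.+-inverseʳ k)) (ℤP.+-identityʳ x))

-- Read p, q as outside/inside neighbours in the projection, p', q' as those
-- in a column, r, s as those in a row: a summand s ≤ D can be dropped
-- together with D from the threshold.
drop-bounded-part : ∀ {p p' q q' s D : ℤ} (r : ℕ) (k : ℤ) → p ≤ p' → q' ≤ q → s ≤ D →
  (p' + + r) + (k + D) ≤ q' + s → p + k ≤ q
drop-bounded-part {p} {p'} {q} {q'} {s} {D} r k p≤p' q'≤q s≤D hyp = +-cancelʳ-≤ _ _ D (begin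
  p + k + D          ≤⟨ ℤP.+-monoˡ-≤ D (ℤP.+-monoˡ-≤ k p≤p') ⟩
  p' + k + D         ≤⟨ ℤP.+-monoˡ-≤ D (ℤP.+-monoˡ-≤ k (ℤP.i≤i+j p' (+ r))) ⟩
  p' + + r + k + D   ≡⟨ ℤP.+-assoc (p' + + r) k D ⟩
  p' + + r + (k + D) ≤⟨ hyp ⟩
  q' + s             ≤⟨ ℤP.+-mono-≤ q'≤q s≤D ⟩
  q + D              ∎)
  where open ℤP.≤-Reasoning

-- If the column part fails the k₁-condition, then the row part carries
-- the k₂-condition.
transfer-deficit : ∀ {p p' q q' r s : ℤ} (k₁ k₂ : ℤ) → p ≤ p' → q' ≤ q → ¬ (p + k₁ ≤ q) →
  (p' + r) + (k₁ + k₂ - + 1) ≤ q' + s → r + k₂ ≤ s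
transfer-deficit {p} {p'} {q} {q'} {r} {s} k₁ k₂ p≤p' q'≤q fails hyp = +-cancelʳ-≤ _ _ (q + + 1) (begin
  r + k₂ + (q + + 1)                 ≤⟨ ℤP.+-monoʳ-≤ (r + k₂) q<p+k₁ ⟩
  r + k₂ + (p + k₁)                  ≤⟨ ℤP.+-monoʳ-≤ (r + k₂) (ℤP.+-monoˡ-≤ k₁ p≤p') ⟩
  r + k₂ + (p' + k₁)                 ≡⟨ regroup r k₂ p' k₁ ⟩
  (p' + r) + (k₁ + k₂ - + 1) + + 1   ≤⟨ ℤP.+-monoˡ-≤ (+ 1) hyp ⟩
  q' + s + + 1                       ≤⟨ ℤP.+-monoˡ-≤ (+ 1) (ℤP.+-monoˡ-≤ s q'≤q) ⟩
  q + s + + 1                        ≡⟨ swap q s ⟩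
  s + (q + + 1)                      ∎)
  where
  open ℤP.≤-Reasoning
  q<p+k₁ : q + + 1 ≤ p + k₁
  q<p+k₁ = subst (_≤ p + k₁) (ℤP.+-comm (+ 1) q) (ℤP.i<j⇒suc[i]≤j (ℤP.≰⇒> fails))
  regroup : ∀ a b c d → a + b + (c + d) ≡ (c + a) + (d + b - + 1) + + 1
  regroup = ℤSolver.solve-∀
  swap : ∀ a b → a + b + + 1 ≡ b + (a + + 1)
  swap = ℤSolver.solve-∀

Defends : ∀ {n} → Graph n → ℤ → VSet n → Fin n → Set
Defends G k S v = + δ G (complement S) v + k ≤ + δ G S v

failing-vertex : ∀ {n} (G : Graph n) k (A : VSet n) → ¬ (∀ v → T (A v) → Defends G k A v) →
  ∃[ v ] T (A v) × ¬ Defends G k A v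
failing-vertex {n} G k A notAlliance with ¬∀⟶∃¬ n _ decide notAlliance
  where
  decide : ∀ v → Dec (T (A v) → Defends G k A v)
  decide v = T? (A v) →-dec (_ ℤP.≤? _)
... | v , notDefends with T? (A v)
...   | yes vA = v , vA , λ defends → notDefends (λ _ → defends)
...   | no ¬vA = ⊥-elim (notDefends (λ vA → ⊥-elim (¬vA vA)))

module _ {n₁ n₂ : ℕ} (G₁ : Graph n₁) (G₂ : Graph n₂) where

  product-condition : ∀ k X a b → Defends (G₁ ×ᴳ G₂) k X (combine a b) →
    (+ δ G₁ (column (complement X) b) a + + δ G₂ (row (complement X) a) b) + k
      ≤ + δ G₁ (column X b) a + + δ G₂ (row X a) b
  product-condition k X a b defends =
    subst₂ (λ x y → x + k ≤ y) (split (complement X)) (split X) defends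
    where
    split : ∀ Y → + δ (G₁ ×ᴳ G₂) Y (combine a b) ≡ + δ G₁ (column Y b) a + + δ G₂ (row Y a) b
    split Y = trans (cong +_ (δ-product G₁ G₂ Y a b)) (ℤP.pos-+ (δ G₁ (column Y b) a) (δ G₂ (row Y a) b))

  product-condition′ : ∀ k X a b → Defends (G₁ ×ᴳ G₂) k X (combine a b) →
    (+ δ G₂ (row (complement X) a) b + + δ G₁ (column (complement X) b) a) + k
      ≤ + δ G₂ (row X a) b + + δ G₁ (column X b) a
  product-condition′ k X a b defends =
    subst₂ (λ x y → x + k ≤ y)
      (ℤP.+-comm (+ δ G₁ (column (complement X) b) a) (+ δ G₂ (row (complement X) a) b))
      (ℤP.+-comm (+ δ G₁ (column X b) a) (+ δ G₂ (row X a) b))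
      (product-condition k X a b defends)

  projection-alliance₁ : ∀ k X → IsDefensiveAlliance (G₁ ×ᴳ G₂) (k + + maxDeg G₂) X →
    IsDefensiveAlliance G₁ k (proj₁ᴾ {n₁} {n₂} X)
  projection-alliance₁ k X (ne , defends) = proj₁-nonempty X ne , defends₁
    where
    defends₁ : ∀ a → T (proj₁ᴾ {n₁} {n₂} X a) → Defends G₁ k (proj₁ᴾ {n₁} {n₂} X) a
    defends₁ a aX with any-elim n₂ (row X a) aX
    ... | b , abX = drop-bounded-part (δ G₂ (row (complement X) a) b) k
      (+≤+ (δ-mono G₁ (complement-antitone (column⊆proj₁ X b)) a))
      (+≤+ (δ-mono G₁ (column⊆proj₁ X b) a))
      (+≤+ (δ≤maxDeg G₂ (row X a) b))
      (product-condition (k + + maxDeg G₂) X a b (defends (combine a b) abX))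

  projection-alliance₂ : ∀ k X → IsDefensiveAlliance (G₁ ×ᴳ G₂) (k + + maxDeg G₁) X →
    IsDefensiveAlliance G₂ k (proj₂ᴾ {n₁} {n₂} X)
  projection-alliance₂ k X (ne , defends) = proj₂-nonempty {n₁} {n₂} X ne , defends₂
    where
    defends₂ : ∀ b → T (proj₂ᴾ {n₁} {n₂} X b) → Defends G₂ k (proj₂ᴾ {n₁} {n₂} X) b
    defends₂ b bX with any-elim n₁ (column X b) bX
    ... | a , abX = drop-bounded-part (δ G₁ (column (complement X) b) a) k
      (+≤+ (δ-mono G₂ (complement-antitone (row⊆proj₂ X a)) b))
      (+≤+ (δ-mono G₂ (row⊆proj₂ X a) b))
      (+≤+ (δ≤maxDeg G₁ (column X b) a))
      (product-condition′ (k + + maxDeg G₁) X a b (defends (combine a b) abX))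

  row-alliance : ∀ k₁ k₂ X a → IsDefensiveAlliance (G₁ ×ᴳ G₂) (k₁ + k₂ - + 1) X →
    T (proj₁ᴾ {n₁} {n₂} X a) → ¬ Defends G₁ k₁ (proj₁ᴾ {n₁} {n₂} X) a →
    IsDefensiveAlliance G₂ k₂ (row X a)
  row-alliance k₁ k₂ X a (_ , defends) aX fails = any-elim n₂ (row X a) aX , defendsRow
    where
    defendsRow : ∀ d → T (row X a d) → Defends G₂ k₂ (row X a) d
    defendsRow d adX = transfer-deficit {r = + δ G₂ (row (complement X) a) d} k₁ k₂
      (+≤+ (δ-mono G₁ (complement-antitone (column⊆proj₁ X d)) a))
      (+≤+ (δ-mono G₁ (column⊆proj₁ X d) a))
      fails
      (product-condition (k₁ + k₂ - + 1) X a d (defends (combine a d) adX))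

theorem4 : ∀ {n₁ n₂ : ℕ} (G₁ : Graph n₁) (G₂ : Graph n₂) (S : VSet (n₁ * n₂)) →
    ((k₁ : ℤ) → IsDAF G₁ k₁ (proj₁ᴾ {n₁} {n₂} S) →
       IsDAF (G₁ ×ᴳ G₂) (k₁ + + maxDeg G₂) S)
    × ((k₂ : ℤ) → IsDAF G₂ k₂ (proj₂ᴾ {n₁} {n₂} S) →
       IsDAF (G₁ ×ᴳ G₂) (k₂ + + maxDeg G₁) S)
    × ((k₁ k₂ : ℤ) → IsDAF G₁ k₁ (proj₁ᴾ {n₁} {n₂} S) → IsDAF G₂ k₂ (proj₂ᴾ {n₁} {n₂} S) →
       IsDAF (G₁ ×ᴳ G₂) (k₁ + k₂ - + 1) S)
theorem4 {n₁} {n₂} G₁ G₂ S = part₁ , part₂ , part₁₂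
  where
  part₁ : ∀ k₁ → IsDAF G₁ k₁ (proj₁ᴾ {n₁} {n₂} S) → IsDAF (G₁ ×ᴳ G₂) (k₁ + + maxDeg G₂) S
  part₁ k₁ daf₁ X X⊆S alliance =
    daf₁ _ (proj₁-mono {n₁} {n₂} X⊆S) (projection-alliance₁ G₁ G₂ k₁ X alliance)

  part₂ : ∀ k₂ → IsDAF G₂ k₂ (proj₂ᴾ {n₁} {n₂} S) → IsDAF (G₁ ×ᴳ G₂) (k₂ + + maxDeg G₁) S
  part₂ k₂ daf₂ X X⊆S alliance =
    daf₂ _ (proj₂-mono {n₁} {n₂} X⊆S) (projection-alliance₂ G₁ G₂ k₂ X alliance)

  -- P₁(X) is not a k₁-alliance, so it fails at some a; the row through a
  -- is then a k₂-alliance inside P₂(S).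
  part₁₂ : ∀ k₁ k₂ → IsDAF G₁ k₁ (proj₁ᴾ {n₁} {n₂} S) → IsDAF G₂ k₂ (proj₂ᴾ {n₁} {n₂} S) →
    IsDAF (G₁ ×ᴳ G₂) (k₁ + k₂ - + 1) S
  part₁₂ k₁ k₂ daf₁ daf₂ X X⊆S alliance@(ne , _)
    with failing-vertex G₁ k₁ _ (λ defends → daf₁ _ (proj₁-mono {n₁} {n₂} X⊆S) (proj₁-nonempty X ne , defends))
  ... | a , aX , fails =
    daf₂ _ (λ e aeX → proj₂-mono {n₁} {n₂} X⊆S e (row⊆proj₂ X a e aeX))
      (row-alliance G₁ G₂ k₁ k₂ X a alliance aX fails)
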